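{- Let $n\ge1$ and let $\mathbf{X}_n$ be the graph on the $n+2$ vertices $0,1,\dots,n+1$ with a double edge from the longer vertex $0$ to the shorter vertex $1$, simple edges $1-2,\dots,(n-1)-n$, and a double edge from the longer vertex $n$ to the shorter vertex $n+1$. Writing labelings as $(b_0;b_1,\dots,b_n;b_{n+1})$, a set of minimal representatives of the classes is: $(0;0,\dots,0;1)$; the labelings $(0;\xi_i^n;0)$ for $i=0,\dots,\lceil n/2\rceil$; and the labelings $(1;\eta_i^n;0)$ for $i=0,\dots,\lceil (n-1)/2\rceil$. In total $\#\mathrm{Cl}(\mathbf{X}_n)=n+3$.
   Context: Generalized Reeder's puzzle: a labeling assigns $b_j\in\mathbb{Z}/2\mathbb{Z}$ to each vertex $j$. Double edges are directed from a longer to a shorter vertex. The move $T_i$ replaces $b_i$ by $b_i+\sum_k b_k\pmod 2$, where $k$ runs over neighbors of $i$ excluding any neighbor that is the shorter endpoint of a double edge at $i$; other labels unchanged. Equivalence is generated by moves; $\mathrm{Cl}(D)$ is the set of classes; a minimal representative is a labeling in its class with the fewest $1$'s. For path vertices $1,\dots,n$ in order, $\xi_r^n$ has $1$'s exactly at $1,3,\dots,2r-1$ and $\eta_r^n$ has $1$'s exactly at $n,n-2,\dots,n-2(r-1)$. -}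

module Defs where

open import Data.Bool using (Bool; true; false; _∧_; _∨_; not; _xor_; if_then_else_)
open import Data.Nat using (ℕ; zero; suc; _+_; _*_; _∸_; _≤_; _<_; _≡ᵇ_; _<ᵇ_; _%_; ⌈_/2⌉)
open import Data.Fin using (Fin; toℕ)
import Data.Fin as Fin
open import Data.Vec using (Vec; []; _∷_; _∷ʳ_; lookup; tabulate; replicate)
open import Data.Product using (Σ; _×_; ∃; ∃-syntax)
open import Data.Sum using (_⊎_)
open import Relation.Nullary using (does)
open import Relation.Binary.PropositionalEquality using (_≡_)
open import Relation.Binary.Construct.Closure.Equivalence using (EqClosure)

record PuzzleGraph (m : ℕ) : Set where
  field
    -- neighbor i k : i and k are joined by an edge (simple or double)
    neighbor  : Fin m → Fin m → Bool
    -- shorterAt i k : there is a double edge at i whose shorter endpoint is k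
    --                 (i.e. a double edge directed from i to k)
    shorterAt : Fin m → Fin m → Bool
open PuzzleGraph public

Labeling : ℕ → Set
Labeling m = Vec Bool m

xorSum : ∀ {m} → (Fin m → Bool) → Bool
xorSum {zero}  f = false
xorSum {suc m} f = f Fin.zero xor xorSum (λ k → f (Fin.suc k))

move : ∀ {m} → PuzzleGraph m → Fin m → Labeling m → Labeling m
move G i b = tabulate λ j →
  if does (j Fin.≟ i)
  then lookup b i xor xorSum (λ k → neighbor G i k ∧ not (shorterAt G i k) ∧ lookup b k)
  else lookup b j

Step : ∀ {m} → PuzzleGraph m → Labeling m → Labeling m → Set
Step G b c = ∃[ i ] c ≡ move G i b

_≈[_]_ : ∀ {m} → Labeling m → PuzzleGraph m → Labeling m → Set
b ≈[ G ] c = EqClosure (Step G) b c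

weight : ∀ {m} → Labeling m → ℕ
weight [] = 0
weight (true ∷ b) = suc (weight b)
weight (false ∷ b) = weight b

IsMinimal : ∀ {m} → PuzzleGraph m → Labeling m → Set
IsMinimal G b = ∀ c → b ≈[ G ] c → weight b ≤ weight c

NumClasses : ∀ {m} → PuzzleGraph m → ℕ → Set
NumClasses {m} G k =
  Σ (Fin k → Labeling m) λ f →
    (∀ i j → f i ≈[ G ] f j → i ≡ j) × (∀ b → ∃[ i ] b ≈[ G ] f i)

absDiff : ℕ → ℕ → ℕ
absDiff a b = (a ∸ b) + (b ∸ a)

X : (n : ℕ) → PuzzleGraph (2 + n)
X n = record
  { neighbor  = λ i k → absDiff (toℕ i) (toℕ k) ≡ᵇ 1
  ; shorterAt = λ i k → ((toℕ i ≡ᵇ 0) ∧ (toℕ k ≡ᵇ 1))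
                      ∨ ((toℕ i ≡ᵇ n) ∧ (toℕ k ≡ᵇ suc n))
  }

lab : ∀ {n} → Bool → Vec Bool n → Bool → Labeling (2 + n)
lab b₀ v b₁ = b₀ ∷ (v ∷ʳ b₁)

-- ξ_r^n : 1's exactly at positions 1,3,…,2r-1 (positions 1..n; Fin index q = position - 1)
ξ : (r n : ℕ) → Vec Bool n
ξ r n = tabulate λ q → (toℕ q % 2 ≡ᵇ 0) ∧ (toℕ q <ᵇ 2 * r)

-- η_r^n : 1's exactly at positions n, n-2, …, n-2(r-1)
η : (r n : ℕ) → Vec Bool n
η r n = tabulate λ q → ((n ∸ suc (toℕ q)) % 2 ≡ᵇ 0) ∧ ((n ∸ suc (toℕ q)) <ᵇ 2 * r)

IsRep : (n : ℕ) → Labeling (2 + n) → Set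
IsRep n b =
  (b ≡ lab false (replicate n false) true)
  ⊎ (∃[ i ] (i ≤ ⌈ n /2⌉ × b ≡ lab false (ξ i n) false))
  ⊎ (∃[ i ] (i ≤ ⌈ (n ∸ 1) /2⌉ × b ≡ lab true (η i n) false))

module Submission where

open import Defs
open import Data.Nat using (ℕ; _≤_; _+_)
open import Data.Product using (_×_; ∃-syntax)
open import Relation.Binary.PropositionalEquality using (_≡_)

open import Data.Bool using (Bool; true; false; _∧_; _∨_; not; _xor_; if_then_else_; T)
import Data.Bool as Bool
open import Data.Bool.Properties
  using (∧-zeroʳ; ∧-identityʳ; ∧-idem; ∧-assoc; not-involutive; not-injective; ¬-not;
         xor-comm; xor-assoc; xor-same; xor-identityʳ)
open import Data.Empty using (⊥-elim)
open import Data.Fin using (Fin; toℕ; fromℕ<)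
import Data.Fin as Fin
open import Data.Fin.Properties using (toℕ<n; toℕ-fromℕ<; toℕ-injective)
open import Data.Nat
  using (zero; suc; _*_; _∸_; _<_; z≤n; s≤s; _≡ᵇ_; _<ᵇ_; _%_; ⌊_/2⌋; ⌈_/2⌉)
open import Data.Nat.Properties
  using (≤-refl; ≤-trans; ≤-pred; <⇒≤; m≤n⇒m<n∨m≡n; m≤n⇒m≤1+n; m≤n+m; m∸n≤m;
         +-suc; +-comm; +-identityʳ; *-suc; +-monoʳ-≤; ≡ᵇ⇒≡; suc-injective;
         ⌊n/2⌋-mono; ⌈n/2⌉-mono; n≡⌊n+n/2⌋; n≡⌈n+n/2⌉; module ≤-Reasoning)
open import Data.Product using (_,_)
open import Data.Sum using (_⊎_; inj₁; inj₂)
import Data.Sum as Sum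
open import Data.Vec using (Vec; []; _∷_; _∷ʳ_; lookup; tabulate; replicate; last)
open import Data.Vec.Properties
  using (lookup∘tabulate; tabulate∘lookup; tabulate-cong; last-∷ʳ; ∷-injective)
open import Function using (_∘_)
open import Relation.Nullary using (does; yes; no)
open import Relation.Binary.PropositionalEquality
  using (refl; sym; trans; cong; cong₂; subst; subst₂; _≢_; isEquivalence; module ≡-Reasoning)
open import Relation.Binary.Construct.Closure.ReflexiveTransitive using (Star; ε; _◅_; _◅◅_)
import Relation.Binary.Construct.Closure.ReflexiveTransitive as Star
open import Relation.Binary.Construct.Closure.Equivalence using (gfold; return; symmetric)

-- Write a labeling as (b₀; b₁ … bₙ₊₁) and put xₖ = bₖ + bₖ₊₁ for k < n and xₙ = bₙ.
-- The move T₀ does nothing, T_t exchanges x_{t-1} and x_t for 1 ≤ t ≤ n, and T_{n+1} adds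
-- xₙ to bₙ₊₁. Hence the number w of 1's among x₀ … xₙ, together with bₙ₊₁ when w = 0, is
-- invariant, and it determines b₀ ≡ w (mod 2) because the x's telescope to b₀. Conversely,
-- exchanges sort the x's, after which xₙ = 1 as soon as w > 0, so that bₙ₊₁ can be toggled:
-- the invariant, which takes n + 3 values, classifies the labelings. The listed labelings
-- realise each value once, and they are minimal because w ≤ b₀ + 2(b₁ + … + bₙ₊₁) forces at
-- least ⌈w/2⌉ ones in every labeling of the class.

bit : Bool → ℕ
bit false = 0
bit true  = 1

odd : ℕ → Bool
odd zero    = false
odd (suc n) = not (odd n)

xor-injective : ∀ p {a a′} → (p xor a) ≡ (p xor a′) → a ≡ a′
xor-injective false e = e
xor-injective true  e = not-injective e

<ᵇ-true : ∀ {k w} → k < w → (k <ᵇ w) ≡ true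
<ᵇ-true {zero}  {suc w} _         = refl
<ᵇ-true {suc k} {suc w} (s≤s k<w) = <ᵇ-true k<w

<ᵇ-false : ∀ {k w} → w ≤ k → (k <ᵇ w) ≡ false
<ᵇ-false {k}     {zero}  _         = refl
<ᵇ-false {suc k} {suc w} (s≤s w≤k) = <ᵇ-false w≤k

2*n≡n+n : ∀ n → 2 * n ≡ n + n
2*n≡n+n n = cong (n +_) (+-identityʳ n)

odd-2*n : ∀ n → odd (2 * n) ≡ false
odd-2*n zero    = refl
odd-2*n (suc n) = trans (cong odd (*-suc 2 n)) (trans (not-involutive _) (odd-2*n n))

odd-bit+2*n : ∀ p n → odd (bit p + 2 * n) ≡ p
odd-bit+2*n false n = odd-2*n n
odd-bit+2*n true  n = cong not (odd-2*n n)

⌊bit+2*n/2⌋ : ∀ p n → ⌊ bit p + 2 * n /2⌋ ≡ n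
⌊bit+2*n/2⌋ false n = trans (cong ⌊_/2⌋ (2*n≡n+n n)) (sym (n≡⌊n+n/2⌋ n))
⌊bit+2*n/2⌋ true  n = trans (cong ⌈_/2⌉ (2*n≡n+n n)) (sym (n≡⌈n+n/2⌉ n))

⌈bit+2*n/2⌉ : ∀ p n → ⌈ bit p + 2 * n /2⌉ ≡ bit p + n
⌈bit+2*n/2⌉ false n = ⌊bit+2*n/2⌋ true n
⌈bit+2*n/2⌉ true  n = cong suc (⌊bit+2*n/2⌋ false n)

bit-odd+2*⌊n/2⌋ : ∀ n → bit (odd n) + 2 * ⌊ n /2⌋ ≡ n
bit-odd+2*⌊n/2⌋ zero          = refl
bit-odd+2*⌊n/2⌋ (suc zero)    = refl
bit-odd+2*⌊n/2⌋ (suc (suc n)) = begin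
  bit (not (not (odd n))) + 2 * suc ⌊ n /2⌋
    ≡⟨ cong₂ (λ p k → bit p + k) (not-involutive (odd n)) (*-suc 2 ⌊ n /2⌋) ⟩
  bit (odd n) + suc (suc (2 * ⌊ n /2⌋))   ≡⟨ trans (+-suc _ _) (cong suc (+-suc _ _)) ⟩
  suc (suc (bit (odd n) + 2 * ⌊ n /2⌋))   ≡⟨ cong (suc ∘ suc) (bit-odd+2*⌊n/2⌋ n) ⟩
  suc (suc n)                             ∎
  where open ≡-Reasoning

⌈suc-n/2⌉ : ∀ n → ⌈ suc n /2⌉ ≡ bit (not (odd n)) + ⌈ n /2⌉
⌈suc-n/2⌉ zero    = refl
⌈suc-n/2⌉ (suc n) rewrite ⌈suc-n/2⌉ n = alternates (odd n) ⌈ n /2⌉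
  where
  alternates : ∀ o k → suc k ≡ bit (not (not o)) + (bit (not o) + k)
  alternates false k = refl
  alternates true  k = refl

⌈n∸1/2⌉≡⌊n/2⌋ : ∀ n → ⌈ (n ∸ 1) /2⌉ ≡ ⌊ n /2⌋
⌈n∸1/2⌉≡⌊n/2⌋ zero    = refl
⌈n∸1/2⌉≡⌊n/2⌋ (suc n) = refl

≤⌊n/2⌋⇒2*≤n : ∀ {i} n → i ≤ ⌊ n /2⌋ → 2 * i ≤ n
≤⌊n/2⌋⇒2*≤n {zero}  n             _        = z≤n
≤⌊n/2⌋⇒2*≤n {suc i} (suc (suc n)) (s≤s i≤) rewrite *-suc 2 i = s≤s (s≤s (≤⌊n/2⌋⇒2*≤n n i≤))

2*≤n⇒≤⌊n/2⌋ : ∀ i {n} → 2 * i ≤ n → i ≤ ⌊ n /2⌋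
2*≤n⇒≤⌊n/2⌋ i {n} 2i≤n = subst (_≤ ⌊ n /2⌋) (⌊bit+2*n/2⌋ false i) (⌊n/2⌋-mono 2i≤n)

weight-∷ : ∀ x {m} (v : Vec Bool m) → weight (x ∷ v) ≡ bit x + weight v
weight-∷ false v = refl
weight-∷ true  v = refl

weight≤length : ∀ {m} (v : Vec Bool m) → weight v ≤ m
weight≤length []          = z≤n
weight≤length (true ∷ v)  = s≤s (weight≤length v)
weight≤length (false ∷ v) = m≤n⇒m≤1+n (weight≤length v)

odd-weight-∷ : ∀ x {m} (v : Vec Bool m) → odd (weight (x ∷ v)) ≡ (x xor odd (weight v))
odd-weight-∷ false v = refl
odd-weight-∷ true  v = refl

at : ∀ {m} → Vec Bool m → ℕ → Bool
at []      _       = false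
at (x ∷ v) zero    = x
at (x ∷ v) (suc k) = at v k

lookup≡at : ∀ {m} (v : Vec Bool m) j → lookup v j ≡ at v (toℕ j)
lookup≡at (x ∷ v) Fin.zero    = refl
lookup≡at (x ∷ v) (Fin.suc j) = lookup≡at v j

does-≟ : ∀ {m} (j i : Fin m) → does (j Fin.≟ i) ≡ (toℕ j ≡ᵇ toℕ i)
does-≟ Fin.zero    Fin.zero    = refl
does-≟ Fin.zero    (Fin.suc i) = refl
does-≟ (Fin.suc j) Fin.zero    = refl
does-≟ (Fin.suc j) (Fin.suc i) = does-≟ j i

if-cong : ∀ {c c′ x x′ y y′ : Bool} → c ≡ c′ → x ≡ x′ → y ≡ y′ →
  (if c then x else y) ≡ (if c′ then x′ else y′)
if-cong refl refl refl = refl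

xorSum-cong : ∀ {m} {f g : Fin m → Bool} → (∀ k → f k ≡ g k) → xorSum f ≡ xorSum g
xorSum-cong {zero}  f≗g = refl
xorSum-cong {suc m} f≗g = cong₂ _xor_ (f≗g Fin.zero) (xorSum-cong (f≗g ∘ Fin.suc))

xorSum-null : ∀ {m} (F : ℕ → Bool) → (∀ k → F k ≡ false) → xorSum {m} (F ∘ toℕ) ≡ false
xorSum-null {zero}  F null = refl
xorSum-null {suc m} F null rewrite null 0 = xorSum-null {m} (F ∘ suc) (null ∘ suc)

xorSum-single : ∀ {m} (F : ℕ → Bool) p → (∀ k → k ≢ p → F k ≡ false) →
  xorSum {m} (F ∘ toℕ) ≡ ((p <ᵇ m) ∧ F p)
xorSum-single {zero}  F p       null = refl
xorSum-single {suc m} F zero    null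
  rewrite xorSum-null {m} (F ∘ suc) (λ k → null (suc k) (λ ())) = xor-identityʳ (F 0)
xorSum-single {suc m} F (suc p) null rewrite null 0 (λ ()) =
  xorSum-single {m} (F ∘ suc) p (λ k k≢p → null (suc k) (k≢p ∘ suc-injective))

xorSum-pair : ∀ {m} (F : ℕ → Bool) p q → p < q → (∀ k → k ≢ p → k ≢ q → F k ≡ false) →
  xorSum {m} (F ∘ toℕ) ≡ (((p <ᵇ m) ∧ F p) xor ((q <ᵇ m) ∧ F q))
xorSum-pair {zero}  F p       q       p<q       null = refl
xorSum-pair {suc m} F zero    (suc q) p<q       null = cong (F 0 xor_)
  (xorSum-single {m} (F ∘ suc) q (λ k k≢q → null (suc k) (λ ()) (k≢q ∘ suc-injective)))
xorSum-pair {suc m} F (suc p) (suc q) (s≤s p<q) null rewrite null 0 (λ ()) (λ ()) =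
  xorSum-pair {m} (F ∘ suc) p q p<q
    (λ k k≢p k≢q → null (suc k) (k≢p ∘ suc-injective) (k≢q ∘ suc-injective))

-- The moves of X n in closed form

absDiff≡1 : ∀ t k → absDiff t k ≡ 1 → k ≡ suc t ⊎ t ≡ suc k
absDiff≡1 zero          zero          ()
absDiff≡1 zero          (suc zero)    _  = inj₁ refl
absDiff≡1 zero          (suc (suc k)) ()
absDiff≡1 (suc zero)    zero          _  = inj₂ refl
absDiff≡1 (suc (suc t)) zero          ()
absDiff≡1 (suc t)       (suc k)       d  = Sum.map (cong suc) (cong suc) (absDiff≡1 t k d)

absDiff-suc-left : ∀ s → absDiff (suc s) s ≡ 1
absDiff-suc-left zero    = refl
absDiff-suc-left (suc s) = absDiff-suc-left s

absDiff-suc-right : ∀ s → absDiff s (suc s) ≡ 1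
absDiff-suc-right zero    = refl
absDiff-suc-right (suc s) = absDiff-suc-right s

≡ᵇ-suc-false : ∀ {s n} → s ≤ n → (s ≡ᵇ suc n) ≡ false
≡ᵇ-suc-false z≤n       = refl
≡ᵇ-suc-false (s≤s s≤n) = ≡ᵇ-suc-false s≤n

<ᵇ∧≢ᵇ : ∀ s n → ((s <ᵇ n) ∧ not (suc s ≡ᵇ n)) ≡ (suc s <ᵇ n)
<ᵇ∧≢ᵇ zero    zero          = refl
<ᵇ∧≢ᵇ zero    (suc zero)    = refl
<ᵇ∧≢ᵇ zero    (suc (suc n)) = refl
<ᵇ∧≢ᵇ (suc s) zero          = refl
<ᵇ∧≢ᵇ (suc s) (suc n)       = <ᵇ∧≢ᵇ s n

summand : ℕ → ℕ → (ℕ → Bool) → ℕ → Bool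
summand n t B k =
  (absDiff t k ≡ᵇ 1) ∧ not (((t ≡ᵇ 0) ∧ (k ≡ᵇ 1)) ∨ ((t ≡ᵇ n) ∧ (k ≡ᵇ suc n))) ∧ B k

-- Vertex 0 adds nothing, its only neighbour being the shorter end of its double edge;
-- vertex s+1 adds the label of s and, unless s+1 is n or n+1, that of s+2.
neighbourSum : ℕ → ℕ → (ℕ → Bool) → Bool
neighbourSum n zero    B = false
neighbourSum n (suc s) B = B s xor ((suc s <ᵇ n) ∧ B (suc (suc s)))

summand-outside : ∀ n t B k → k ≢ t ∸ 1 → k ≢ suc t → summand n t B k ≡ false
summand-outside n t B k k≢t-1 k≢t+1 with absDiff t k ≡ᵇ 1 in adjacent
... | false = refl
... | true with absDiff≡1 t k (≡ᵇ⇒≡ _ _ (subst T (sym adjacent) _))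
...   | inj₁ k≡t+1 = ⊥-elim (k≢t+1 k≡t+1)
...   | inj₂ t≡k+1 = ⊥-elim (k≢t-1 (cong (_∸ 1) (sym t≡k+1)))

summand-below : ∀ n s B → s ≤ n → summand n (suc s) B s ≡ B s
summand-below n s B s≤n
  rewrite absDiff-suc-left s | ≡ᵇ-suc-false s≤n | ∧-zeroʳ (suc s ≡ᵇ n) = refl

summand-above : ∀ n s B →
  ((s <ᵇ n) ∧ summand n (suc s) B (suc (suc s))) ≡ ((suc s <ᵇ n) ∧ B (suc (suc s)))
summand-above n s B rewrite absDiff-suc-right (suc s) | ∧-idem (suc s ≡ᵇ n) =
  trans (sym (∧-assoc (s <ᵇ n) _ _)) (cong (_∧ B (suc (suc s))) (<ᵇ∧≢ᵇ s n))

xorSum-X : ∀ n (i : Fin (2 + n)) (b : Labeling (2 + n)) →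
  xorSum (λ k → neighbor (X n) i k ∧ not (shorterAt (X n) i k) ∧ lookup b k)
    ≡ neighbourSum n (toℕ i) (at b)
xorSum-X n i b = begin
  xorSum (λ k → term k (lookup b k))
    ≡⟨ xorSum-cong {2 + n} (λ k → cong (term k) (lookup≡at b k)) ⟩
  xorSum {2 + n} (summand n t B ∘ toℕ)
    ≡⟨ xorSum-pair {2 + n} (summand n t B) (t ∸ 1) (suc t) (s≤s (m∸n≤m t 1))
                   (summand-outside n t B) ⟩
  ((t ∸ 1 <ᵇ 2 + n) ∧ summand n t B (t ∸ 1)) xor ((suc t <ᵇ 2 + n) ∧ summand n t B (suc t))
    ≡⟨ evaluate t (≤-pred (toℕ<n i)) ⟩
  neighbourSum n t B                   ∎
  where
  open ≡-Reasoning
  t = toℕ i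
  B = at b
  term : Fin (2 + n) → Bool → Bool
  term k x = neighbor (X n) i k ∧ not (shorterAt (X n) i k) ∧ x
  evaluate : ∀ t → t ≤ suc n →
    (((t ∸ 1 <ᵇ 2 + n) ∧ summand n t B (t ∸ 1)) xor ((suc t <ᵇ 2 + n) ∧ summand n t B (suc t)))
      ≡ neighbourSum n t B
  evaluate zero    _         = refl
  evaluate (suc s) (s≤s s≤n) = cong₂ _xor_
    (trans (cong (_∧ summand n (suc s) B s) (<ᵇ-true (s≤s (m≤n⇒m≤1+n s≤n))))
           (summand-below n s B s≤n))
    (summand-above n s B)

moveSpec : ℕ → ℕ → (ℕ → Bool) → ℕ → Bool
moveSpec n t B k = if k ≡ᵇ t then B t xor neighbourSum n t B else B k

lookup-move-X : ∀ n (i : Fin (2 + n)) b j →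
  lookup (move (X n) i b) j ≡ moveSpec n (toℕ i) (at b) (toℕ j)
lookup-move-X n i b j = trans (lookup∘tabulate entry j)
  (if-cong (does-≟ j i) (cong₂ _xor_ (lookup≡at b i) (xorSum-X n i b)) (lookup≡at b j))
  where
  entry : Fin (2 + n) → Bool
  entry j = if does (j Fin.≟ i)
    then lookup b i xor xorSum (λ k → neighbor (X n) i k ∧ not (shorterAt (X n) i k) ∧ lookup b k)
    else lookup b j

-- The length of the vector locates the end of the path: length 1 is vertex n+1, and at
-- length 2 the right neighbour is the shorter end of the double edge at vertex n.
moveHead : ∀ {m} → Bool → Vec Bool (suc m) → Vec Bool (suc m)
moveHead {zero}        p (a ∷ [])     = (a xor p) ∷ []
moveHead {suc zero}    p (a ∷ c ∷ []) = (a xor p) ∷ c ∷ []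
moveHead {suc (suc m)} p (a ∷ c ∷ r)  = (a xor (p xor c)) ∷ c ∷ r

moveIn : ∀ {m} → ℕ → Bool → Vec Bool (suc m) → Vec Bool (suc m)
moveIn         zero    p r        = moveHead p r
moveIn {zero}  (suc t) p (a ∷ []) = a ∷ []
moveIn {suc m} (suc t) p (a ∷ r)  = a ∷ moveIn t a r

moveAt : ∀ {n} → ℕ → Labeling (2 + n) → Labeling (2 + n)
moveAt zero    b       = b
moveAt (suc t) (p ∷ r) = p ∷ moveIn t p r

at-moveIn : ∀ {m} t p (r : Vec Bool (suc m)) k → t ≤ m →
  at (moveIn t p r) k ≡ moveSpec m (suc t) (at (p ∷ r)) (suc k)
at-moveIn {zero}        zero    p (a ∷ [])     zero    _ = cong (a xor_) (sym (xor-identityʳ p))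
at-moveIn {zero}        zero    p (a ∷ [])     (suc k) _ = refl
at-moveIn {suc zero}    zero    p (a ∷ c ∷ []) zero    _ = cong (a xor_) (sym (xor-identityʳ p))
at-moveIn {suc zero}    zero    p (a ∷ c ∷ []) (suc k) _ = refl
at-moveIn {suc (suc m)} zero    p (a ∷ c ∷ r)  zero    _ = refl
at-moveIn {suc (suc m)} zero    p (a ∷ c ∷ r)  (suc k) _ = refl
at-moveIn {suc m}       (suc t) p (a ∷ r)      zero    _ = refl
at-moveIn {suc m}       (suc t) p (a ∷ r)      (suc k) (s≤s t≤m) = at-moveIn t a r k t≤m

at-moveAt : ∀ {n} t (b : Labeling (2 + n)) k → t ≤ suc n →
  at (moveAt t b) k ≡ moveSpec n t (at b) k
at-moveAt zero    b       zero    _         = sym (xor-identityʳ _)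
at-moveAt zero    b       (suc k) _         = refl
at-moveAt (suc t) (p ∷ r) zero    _         = refl
at-moveAt (suc t) (p ∷ r) (suc k) (s≤s t≤n) = at-moveIn t p r k t≤n

move-X : ∀ n (i : Fin (2 + n)) b → move (X n) i b ≡ moveAt (toℕ i) b
move-X n i b = begin
  move (X n) i b                         ≡⟨ tabulate∘lookup _ ⟨
  tabulate (lookup (move (X n) i b))     ≡⟨ tabulate-cong sameEntries ⟩
  tabulate (lookup (moveAt (toℕ i) b))   ≡⟨ tabulate∘lookup _ ⟩
  moveAt (toℕ i) b                       ∎
  where
  open ≡-Reasoning
  sameEntries : ∀ j → lookup (move (X n) i b) j ≡ lookup (moveAt (toℕ i) b) j
  sameEntries j = begin
    lookup (move (X n) i b) j           ≡⟨ lookup-move-X n i b j ⟩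
    moveSpec n (toℕ i) (at b) (toℕ j)   ≡⟨ at-moveAt (toℕ i) b (toℕ j) (≤-pred (toℕ<n i)) ⟨
    at (moveAt (toℕ i) b) (toℕ j)       ≡⟨ lookup≡at (moveAt (toℕ i) b) j ⟨
    lookup (moveAt (toℕ i) b) j         ∎

moveAt-step : ∀ {n} t (b : Labeling (2 + n)) → t < 2 + n → Step (X n) b (moveAt t b)
moveAt-step t b t<2+n = fromℕ< t<2+n ,
  sym (trans (move-X _ (fromℕ< t<2+n) b) (cong (λ s → moveAt s b) (toℕ-fromℕ< t<2+n)))

-- The class invariant

-- diffs b₀ (b₁ … bₙ₊₁) = (b₀+b₁, b₁+b₂, …, bₙ₋₁+bₙ, bₙ); it ignores bₙ₊₁.
diffs : ∀ {m} → Bool → Vec Bool (suc m) → Vec Bool (suc m)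
diffs {zero}  p (a ∷ []) = p ∷ []
diffs {suc m} p (a ∷ r)  = (p xor a) ∷ diffs a r

swap : ∀ {A : Set} {m} → ℕ → Vec A m → Vec A m
swap zero    (a ∷ c ∷ xs) = c ∷ a ∷ xs
swap (suc t) (a ∷ xs)     = a ∷ swap t xs
swap _       xs           = xs

weight-swap : ∀ {m} t (x : Vec Bool m) → weight (swap t x) ≡ weight x
weight-swap zero    []                  = refl
weight-swap zero    (a ∷ [])            = refl
weight-swap zero    (false ∷ false ∷ x) = refl
weight-swap zero    (false ∷ true ∷ x)  = refl
weight-swap zero    (true ∷ false ∷ x)  = refl
weight-swap zero    (true ∷ true ∷ x)   = refl
weight-swap (suc t) []                  = refl
weight-swap (suc t) (false ∷ x)         = weight-swap t x
weight-swap (suc t) (true ∷ x)          = cong suc (weight-swap t x)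

diffs-moveIn : ∀ {m} t p (r : Vec Bool (suc m)) → t < m →
  diffs p (moveIn t p r) ≡ swap t (diffs p r)
diffs-moveIn {suc zero}    zero    p (a ∷ c ∷ []) _ = boolean p a
  where
  boolean : ∀ p a → (p xor (a xor p)) ∷ (a xor p) ∷ [] ≡ a ∷ (p xor a) ∷ []
  boolean false false = refl
  boolean false true  = refl
  boolean true  false = refl
  boolean true  true  = refl
diffs-moveIn {suc (suc m)} zero    p (a ∷ c ∷ r)  _ = boolean p a c
  where
  boolean : ∀ p a c → (p xor (a xor (p xor c))) ∷ ((a xor (p xor c)) xor c) ∷ diffs c r
                        ≡ (a xor c) ∷ (p xor a) ∷ diffs c r
  boolean false false false = refl
  boolean false false true  = refl
  boolean false true  false = refl
  boolean false true  true  = refl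
  boolean true  false false = refl
  boolean true  false true  = refl
  boolean true  true  false = refl
  boolean true  true  true  = refl
diffs-moveIn {suc m} (suc t) p (a ∷ r) (s≤s t<m) = cong ((p xor a) ∷_) (diffs-moveIn t a r t<m)

last-moveIn : ∀ {m} t p (r : Vec Bool (suc m)) → t < m → last (moveIn t p r) ≡ last r
last-moveIn {suc zero}    zero    p (a ∷ c ∷ []) _         = refl
last-moveIn {suc (suc m)} zero    p (a ∷ c ∷ r)  _         = refl
last-moveIn {suc m}       (suc t) p (a ∷ r)      (s≤s t<m) = last-moveIn t a r t<m

diffs-moveIn-end : ∀ {m} p (r : Vec Bool (suc m)) → diffs p (moveIn m p r) ≡ diffs p r
diffs-moveIn-end {zero}  p (a ∷ []) = refl
diffs-moveIn-end {suc m} p (a ∷ r)  = cong ((p xor a) ∷_) (diffs-moveIn-end a r)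

last-moveIn-end : ∀ {m} p (r : Vec Bool (suc m)) →
  last (moveIn m p r) ≡ (last r xor last (diffs p r))
last-moveIn-end {zero}  p (a ∷ []) = refl
last-moveIn-end {suc m} p (a ∷ r)  = last-moveIn-end a r

odd-weight-diffs : ∀ {m} p (r : Vec Bool (suc m)) → odd (weight (diffs p r)) ≡ p
odd-weight-diffs {zero}  false (a ∷ []) = refl
odd-weight-diffs {zero}  true  (a ∷ []) = refl
odd-weight-diffs {suc m} p     (a ∷ r)  = begin
  odd (weight ((p xor a) ∷ diffs a r))     ≡⟨ odd-weight-∷ (p xor a) (diffs a r) ⟩
  (p xor a) xor odd (weight (diffs a r))   ≡⟨ cong ((p xor a) xor_) (odd-weight-diffs a r) ⟩
  (p xor a) xor a                          ≡⟨ xor-assoc p a a ⟩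
  p xor (a xor a)                          ≡⟨ cong (p xor_) (xor-same a) ⟩
  p xor false                              ≡⟨ xor-identityʳ p ⟩
  p                                        ∎
  where open ≡-Reasoning

-- Index 0 is the class of (0;0…0;1); any other index is 1 + the number of 1's of diffs.
classCode : ℕ → Bool → ℕ
classCode zero    true  = 0
classCode zero    false = 1
classCode (suc w) _     = suc (suc w)

classIndex : ∀ {n} → Labeling (2 + n) → ℕ
classIndex (p ∷ r) = classCode (weight (diffs p r)) (last r)

classCode≤ : ∀ w y → classCode w y ≤ suc w
classCode≤ zero    true  = z≤n
classCode≤ zero    false = ≤-refl
classCode≤ (suc w) _     = ≤-refl

classCode-false : ∀ w → classCode w false ≡ suc w
classCode-false zero    = refl
classCode-false (suc w) = refl

classCode-injective : ∀ {w w′ y y′} → classCode w y ≡ classCode w′ y′ → w ≡ w′ × (w ≡ 0 → y ≡ y′)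
classCode-injective {zero}  {zero}  {true}  {true}  _    = refl , λ _ → refl
classCode-injective {zero}  {zero}  {false} {false} _    = refl , λ _ → refl
classCode-injective {suc w} {suc w} {y}     {y′}    refl = refl , λ ()
classCode-injective {zero}  {zero}  {true}  {false} ()
classCode-injective {zero}  {zero}  {false} {true}  ()
classCode-injective {zero}  {suc _} {true}          ()
classCode-injective {zero}  {suc _} {false}         ()
classCode-injective {suc _} {zero}  {_}     {true}  ()
classCode-injective {suc _} {zero}  {_}     {false} ()

classCode-toggle : ∀ {m} (x : Vec Bool (suc m)) y →
  classCode (weight x) (y xor last x) ≡ classCode (weight x) y
classCode-toggle {zero}  (false ∷ []) y = cong (classCode 0) (xor-identityʳ y)
classCode-toggle {zero}  (true ∷ [])  y = refl
classCode-toggle {suc m} (false ∷ x)  y = classCode-toggle x y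
classCode-toggle {suc m} (true ∷ x)   y = refl

classIndex≤ : ∀ {n} (b : Labeling (2 + n)) → classIndex b ≤ 2 + n
classIndex≤ (p ∷ r) = ≤-trans (classCode≤ _ (last r)) (s≤s (weight≤length (diffs p r)))

classIndex-moveAt : ∀ {n} t (b : Labeling (2 + n)) → t ≤ suc n →
  classIndex (moveAt t b) ≡ classIndex b
classIndex-moveAt zero    b       _         = refl
classIndex-moveAt (suc t) (p ∷ r) (s≤s t≤n) with m≤n⇒m<n∨m≡n t≤n
... | inj₁ t<n
  rewrite diffs-moveIn t p r t<n | last-moveIn t p r t<n | weight-swap t (diffs p r) = refl
... | inj₂ refl
  rewrite diffs-moveIn-end p r | last-moveIn-end p r = classCode-toggle (diffs p r) (last r)

≈⇒classIndex≡ : ∀ {n} {b c : Labeling (2 + n)} → b ≈[ X n ] c → classIndex b ≡ classIndex c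
≈⇒classIndex≡ {n} = gfold isEquivalence classIndex (λ {b} {c} → invariant {b} {c})
  where
  invariant : ∀ {b c} → Step (X n) b c → classIndex b ≡ classIndex c
  invariant {b} (i , refl) = sym (trans (cong classIndex (move-X n i b))
                                        (classIndex-moveAt (toℕ i) b (≤-pred (toℕ<n i))))

-- Labelings with the same invariant are equivalent

AdjacentSwap : ∀ {A : Set} {m} → Vec A m → Vec A m → Set
AdjacentSwap {m = m} x y = ∃[ t ] suc t < m × y ≡ swap t x

∷-swaps : ∀ {A : Set} {m} a {x y : Vec A m} →
  Star AdjacentSwap x y → Star AdjacentSwap (a ∷ x) (a ∷ y)
∷-swaps a = Star.gmap (a ∷_) λ { (t , t+1<m , refl) → suc t , s≤s t+1<m , refl }

-- 0 … 0 1 … 1 with w ones when w ≤ m: the entry at distance k from the end is 1 iff k < w.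
sorted : ℕ → (m : ℕ) → Vec Bool m
sorted w zero    = []
sorted w (suc m) = (m <ᵇ w) ∷ sorted w m

sorted-full : ∀ {w} m → m ≤ w → sorted w m ≡ replicate m true
sorted-full zero    _   = refl
sorted-full (suc m) m<w rewrite <ᵇ-true m<w = cong (true ∷_) (sorted-full m (<⇒≤ m<w))

last-sorted : ∀ {w} m → w ≢ 0 → last (sorted w (suc m)) ≡ true
last-sorted {zero}  m       w≢0 = ⊥-elim (w≢0 refl)
last-sorted {suc w} zero    _   = refl
last-sorted {suc w} (suc m) w≢0 = last-sorted m w≢0

bubble : ∀ w m → w ≤ m → Star AdjacentSwap (true ∷ sorted w m) (sorted (suc w) (suc m))
bubble zero zero z≤n = ε
bubble w (suc m) w≤1+m with m≤n⇒m<n∨m≡n w≤1+m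
... | inj₁ (s≤s w≤m) rewrite <ᵇ-false w≤m =
  (0 , s≤s (s≤s z≤n) , refl) ◅ ∷-swaps false (bubble w m w≤m)
... | inj₂ refl = subst₂ (Star AdjacentSwap)
  (cong (true ∷_) (sym (sorted-full (suc m) ≤-refl))) (sym (sorted-full (suc (suc m)) ≤-refl)) ε

sortSwaps : ∀ {m} (x : Vec Bool m) → Star AdjacentSwap x (sorted (weight x) m)
sortSwaps []          = ε
sortSwaps (false ∷ x) rewrite <ᵇ-false (weight≤length x) = ∷-swaps false (sortSwaps x)
sortSwaps (true ∷ x)  = ∷-swaps true (sortSwaps x) ◅◅ bubble (weight x) _ (weight≤length x)

liftSwaps : ∀ {n} p {x y : Vec Bool (suc n)} → Star AdjacentSwap x y → ∀ r → diffs p r ≡ x →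
  ∃[ r′ ] diffs p r′ ≡ y × last r′ ≡ last r × (p ∷ r) ≈[ X n ] (p ∷ r′)
liftSwaps p ε r refl = r , refl , refl , ε
liftSwaps p ((t , t+1<m , refl) ◅ swaps) r refl
  with r′ , diffs≡ , last≡ , r≈r′
         ← liftSwaps p swaps (moveIn t p r) (diffs-moveIn t p r (≤-pred t+1<m))
  = r′ , diffs≡ , trans last≡ (last-moveIn t p r (≤-pred t+1<m)) ,
    return (moveAt-step (suc t) (p ∷ r) (m≤n⇒m≤1+n t+1<m)) ◅◅ r≈r′

-- Sorting diffs keeps bₙ₊₁; once diffs is nonzero, its sorted last entry bₙ = 1 lets the move
-- at vertex n+1 set bₙ₊₁ at will.
≈-sorted : ∀ {n} p (r : Vec Bool (suc n)) y → (weight (diffs p r) ≡ 0 → last r ≡ y) →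
  ∃[ r′ ] diffs p r′ ≡ sorted (weight (diffs p r)) (suc n) × last r′ ≡ y × (p ∷ r) ≈[ X n ] (p ∷ r′)
≈-sorted {n} p r y zero⇒last≡y with liftSwaps p (sortSwaps (diffs p r)) r refl
... | r′ , diffs≡ , last≡ , r≈r′ with last r Bool.≟ y
...   | yes last≡y = r′ , diffs≡ , trans last≡ last≡y , r≈r′
...   | no  last≢y = moveIn n p r′ , trans (diffs-moveIn-end p r′) diffs≡ , toggled ,
        r≈r′ ◅◅ return (moveAt-step (suc n) (p ∷ r′) ≤-refl)
  where
  open ≡-Reasoning
  toggled : last (moveIn n p r′) ≡ y
  toggled = begin
    last (moveIn n p r′)            ≡⟨ last-moveIn-end p r′ ⟩
    last r′ xor last (diffs p r′)
      ≡⟨ cong₂ _xor_ last≡ (trans (cong last diffs≡) (last-sorted n (last≢y ∘ zero⇒last≡y))) ⟩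
    last r xor true                 ≡⟨ xor-comm (last r) true ⟩
    not (last r)                    ≡⟨ ¬-not (last≢y ∘ sym) ⟨
    y                               ∎

diffs-injective : ∀ {m} p (r r′ : Vec Bool (suc m)) →
  diffs p r ≡ diffs p r′ → last r ≡ last r′ → r ≡ r′
diffs-injective {zero}  p (a ∷ []) (a′ ∷ []) _ last≡ = cong (_∷ []) last≡
diffs-injective {suc m} p (a ∷ r) (a′ ∷ r′) diffs≡ last≡ with ∷-injective diffs≡
... | head≡ , tail≡ with xor-injective p head≡
...   | refl = cong (a ∷_) (diffs-injective a r r′ tail≡ last≡)

classIndex≡⇒≈ : ∀ {n} (b c : Labeling (2 + n)) → classIndex b ≡ classIndex c → b ≈[ X n ] c
classIndex≡⇒≈ {n} (p ∷ r) (p′ ∷ r′) same with classCode-injective same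
... | w≡w′ , zero⇒last≡
  with trans (sym (odd-weight-diffs p r)) (trans (cong odd w≡w′) (odd-weight-diffs p′ r′))
...   | refl
  with r₁ , diffs₁ , last₁ , b≈ ← ≈-sorted p r (last r′) zero⇒last≡
     | r₂ , diffs₂ , last₂ , c≈ ← ≈-sorted p r′ (last r′) (λ _ → refl)
  = b≈ ◅◅ subst (λ s → (p ∷ s) ≈[ X n ] (p ∷ r′)) (sym r₁≡r₂) (symmetric (Step (X n)) c≈)
  where
  r₁≡r₂ : r₁ ≡ r₂
  r₁≡r₂ = diffs-injective p r₁ r₂
    (trans diffs₁ (trans (cong (λ w → sorted w (suc n)) w≡w′) (sym diffs₂)))
    (trans last₁ (sym last₂))

-- A lower bound for the weight in each class

weight-diffs≤ : ∀ {m} p (r : Vec Bool (suc m)) → weight (diffs p r) ≤ bit p + 2 * weight r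
weight-diffs≤ {zero}  false (a ∷ []) = z≤n
weight-diffs≤ {zero}  true  (a ∷ []) = s≤s z≤n
weight-diffs≤ {suc m} p     (a ∷ r)  = begin
  weight ((p xor a) ∷ diffs a r)           ≡⟨ weight-∷ (p xor a) (diffs a r) ⟩
  bit (p xor a) + weight (diffs a r)       ≤⟨ +-monoʳ-≤ (bit (p xor a)) (weight-diffs≤ a r) ⟩
  bit (p xor a) + (bit a + 2 * weight r)   ≤⟨ bits p a (weight r) ⟩
  bit p + 2 * (bit a + weight r)           ≡⟨ cong (λ k → bit p + 2 * k) (weight-∷ a r) ⟨
  bit p + 2 * weight (a ∷ r)               ∎
  where
  open ≤-Reasoning
  bits : ∀ p a k → bit (p xor a) + (bit a + 2 * k) ≤ bit p + 2 * (bit a + k)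
  bits false false k = ≤-refl
  bits false true  k rewrite *-suc 2 k = ≤-refl
  bits true  false k = ≤-refl
  bits true  true  k rewrite *-suc 2 k = m≤n+m (suc (2 * k)) 2

minWeight : ℕ → ℕ
minWeight zero    = 1
minWeight (suc w) = ⌈ w /2⌉

1≤weight : ∀ {m} (r : Vec Bool (suc m)) → last r ≡ true → 1 ≤ weight r
1≤weight {zero}  (true ∷ [])  _     = s≤s z≤n
1≤weight {suc m} (true ∷ r)   _     = s≤s z≤n
1≤weight {suc m} (false ∷ r)  last≡ = 1≤weight r last≡

minWeight≤weight : ∀ {n} (b : Labeling (2 + n)) → minWeight (classIndex b) ≤ weight b
minWeight≤weight (p ∷ r) = bound (weight (diffs p r)) (last r) refl ⌈w/2⌉≤
  where
  open ≤-Reasoning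
  r≤b : weight r ≤ weight (p ∷ r)
  r≤b = subst (weight r ≤_) (sym (weight-∷ p r)) (m≤n+m _ _)
  ⌈w/2⌉≤ : ⌈ weight (diffs p r) /2⌉ ≤ weight (p ∷ r)
  ⌈w/2⌉≤ = begin
    ⌈ weight (diffs p r) /2⌉     ≤⟨ ⌈n/2⌉-mono (weight-diffs≤ p r) ⟩
    ⌈ bit p + 2 * weight r /2⌉   ≡⟨ ⌈bit+2*n/2⌉ p (weight r) ⟩
    bit p + weight r             ≡⟨ weight-∷ p r ⟨
    weight (p ∷ r)               ∎
  bound : ∀ w y → y ≡ last r → ⌈ w /2⌉ ≤ weight (p ∷ r) → minWeight (classCode w y) ≤ weight (p ∷ r)
  bound zero    true  y≡last _      = ≤-trans (1≤weight r (sym y≡last)) r≤b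
  bound zero    false _      _      = z≤n
  bound (suc w) y     _      ⌈w/2⌉≤ = ⌈w/2⌉≤

-- The listed representatives

-- the number of changes in the sequence p, v₁, …, vₘ, 0
changes : ∀ {m} → Bool → Vec Bool m → ℕ
changes p []      = bit p
changes p (a ∷ v) = bit (p xor a) + changes a v

weight-diffs-∷ʳ : ∀ {m} p (v : Vec Bool m) y → weight (diffs p (v ∷ʳ y)) ≡ changes p v
weight-diffs-∷ʳ false []      y = refl
weight-diffs-∷ʳ true  []      y = refl
weight-diffs-∷ʳ p     (a ∷ v) y =
  trans (weight-∷ (p xor a) (diffs a (v ∷ʳ y))) (cong (bit (p xor a) +_) (weight-diffs-∷ʳ a v y))

classIndex-lab : ∀ {n} p (v : Vec Bool n) y → classIndex (lab p v y) ≡ classCode (changes p v) y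
classIndex-lab p v y rewrite weight-diffs-∷ʳ p v y | last-∷ʳ y v = refl

weight-∷ʳ-false : ∀ {m} (v : Vec Bool m) → weight (v ∷ʳ false) ≡ weight v
weight-∷ʳ-false []          = refl
weight-∷ʳ-false (false ∷ v) = weight-∷ʳ-false v
weight-∷ʳ-false (true ∷ v)  = cong suc (weight-∷ʳ-false v)

weight-lab-false : ∀ {n} p (v : Vec Bool n) → weight (lab p v false) ≡ bit p + weight v
weight-lab-false p v = trans (weight-∷ p (v ∷ʳ false)) (cong (bit p +_) (weight-∷ʳ-false v))

changes-zeros : ∀ n → changes false (replicate n false) ≡ 0
changes-zeros zero    = refl
changes-zeros (suc n) = changes-zeros n

weight-zeros : ∀ n → weight (replicate n false) ≡ 0
weight-zeros zero    = refl
weight-zeros (suc n) = weight-zeros n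

ξ-zero : ∀ n → ξ 0 n ≡ replicate n false
ξ-zero n = trans (tabulate-cong (λ q → ∧-zeroʳ _)) (tabulate-false n)
  where
  tabulate-false : ∀ n → tabulate {n = n} (λ _ → false) ≡ replicate n false
  tabulate-false zero    = refl
  tabulate-false (suc n) = cong (false ∷_) (tabulate-false n)

ξ-suc : ∀ i n → ξ (suc i) (suc (suc n)) ≡ true ∷ false ∷ ξ i n
ξ-suc i n = cong (λ v → true ∷ false ∷ v) (tabulate-cong shift)
  where
  shift : ∀ q → ((suc (suc (toℕ q)) % 2 ≡ᵇ 0) ∧ (suc (suc (toℕ q)) <ᵇ 2 * suc i))
              ≡ ((toℕ q % 2 ≡ᵇ 0) ∧ (toℕ q <ᵇ 2 * i))
  shift q = cong (λ k → (toℕ q % 2 ≡ᵇ 0) ∧ (suc (suc (toℕ q)) <ᵇ k)) (*-suc 2 i)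

changes-ξ : ∀ i n → i ≤ ⌈ n /2⌉ → changes false (ξ i n) ≡ 2 * i
changes-ξ zero    n             _         =
  trans (cong (changes false) (ξ-zero n)) (changes-zeros n)
changes-ξ (suc i) (suc zero)    (s≤s z≤n) = refl
changes-ξ (suc i) (suc (suc n)) (s≤s i≤)  = begin
  changes false (ξ (suc i) (suc (suc n)))  ≡⟨ cong (changes false) (ξ-suc i n) ⟩
  suc (suc (changes false (ξ i n)))        ≡⟨ cong (suc ∘ suc) (changes-ξ i n i≤) ⟩
  suc (suc (2 * i))                        ≡⟨ *-suc 2 i ⟨
  2 * suc i                                ∎
  where open ≡-Reasoning

weight-ξ : ∀ i n → i ≤ ⌈ n /2⌉ → weight (ξ i n) ≡ i
weight-ξ zero    n             _         = trans (cong weight (ξ-zero n)) (weight-zeros n)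
weight-ξ (suc i) (suc zero)    (s≤s z≤n) = refl
weight-ξ (suc i) (suc (suc n)) (s≤s i≤)  =
  trans (cong weight (ξ-suc i n)) (cong suc (weight-ξ i n i≤))

%2≡ᵇ0 : ∀ n → (n % 2 ≡ᵇ 0) ≡ not (odd n)
%2≡ᵇ0 zero          = refl
%2≡ᵇ0 (suc zero)    = refl
%2≡ᵇ0 (suc (suc n)) = trans (%2≡ᵇ0 n) (sym (not-involutive (not (odd n))))

η-padded : ∀ i n → 2 * i ≤ n → η i (suc n) ≡ false ∷ η i n
η-padded i n 2i≤n rewrite <ᵇ-false 2i≤n = cong (_∷ η i n) (∧-zeroʳ _)

-- For n ≤ 2i the vector η i n has 1's at all the positions n, n-2, ….
η-full : ∀ i n → n < 2 * i → η i (suc n) ≡ not (odd n) ∷ η i n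
η-full i n n<2i rewrite <ᵇ-true n<2i = cong (_∷ η i n) (trans (∧-identityʳ _) (%2≡ᵇ0 n))

changes-η-full : ∀ i n p → n ≤ 2 * i → changes p (η i n) ≡ bit (p xor odd n) + n
changes-η-full i zero    false _    = refl
changes-η-full i zero    true  _    = refl
changes-η-full i (suc n) p     n<2i = begin
  changes p (η i (suc n))
    ≡⟨ cong (changes p) (η-full i n n<2i) ⟩
  bit (p xor not o) + changes (not o) (η i n)
    ≡⟨ cong (bit (p xor not o) +_) (changes-η-full i n (not o) (<⇒≤ n<2i)) ⟩
  bit (p xor not o) + (bit (not o xor o) + n)
    ≡⟨ cong (λ k → bit (p xor not o) + (k + n)) (alternates o) ⟩
  bit (p xor not o) + suc n
    ∎
  where
  open ≡-Reasoning
  o = odd n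
  alternates : ∀ o → bit (not o xor o) ≡ 1
  alternates false = refl
  alternates true  = refl

weight-η-full : ∀ i n → n ≤ 2 * i → weight (η i n) ≡ ⌈ n /2⌉
weight-η-full i zero    _    = refl
weight-η-full i (suc n) n<2i = begin
  weight (η i (suc n))                 ≡⟨ cong weight (η-full i n n<2i) ⟩
  weight (not (odd n) ∷ η i n)         ≡⟨ weight-∷ (not (odd n)) (η i n) ⟩
  bit (not (odd n)) + weight (η i n)
    ≡⟨ cong (bit (not (odd n)) +_) (weight-η-full i n (<⇒≤ n<2i)) ⟩
  bit (not (odd n)) + ⌈ n /2⌉          ≡⟨ ⌈suc-n/2⌉ n ⟨
  ⌈ suc n /2⌉                          ∎
  where open ≡-Reasoning

changes-η : ∀ i n p → 2 * i ≤ n → changes p (η i n) ≡ bit p + 2 * i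
changes-η i n p 2i≤n with m≤n⇒m<n∨m≡n 2i≤n
... | inj₂ refl = begin
  changes p (η i (2 * i))           ≡⟨ changes-η-full i (2 * i) p ≤-refl ⟩
  bit (p xor odd (2 * i)) + 2 * i   ≡⟨ cong (λ q → bit (p xor q) + 2 * i) (odd-2*n i) ⟩
  bit (p xor false) + 2 * i         ≡⟨ cong (λ q → bit q + 2 * i) (xor-identityʳ p) ⟩
  bit p + 2 * i                     ∎
  where open ≡-Reasoning
changes-η i (suc n) p _ | inj₁ (s≤s 2i≤n) = begin
  changes p (η i (suc n))                     ≡⟨ cong (changes p) (η-padded i n 2i≤n) ⟩
  bit (p xor false) + changes false (η i n)
    ≡⟨ cong₂ (λ q k → bit q + k) (xor-identityʳ p) (changes-η i n false 2i≤n) ⟩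
  bit p + 2 * i                               ∎
  where open ≡-Reasoning

weight-η : ∀ i n → 2 * i ≤ n → weight (η i n) ≡ i
weight-η i n 2i≤n with m≤n⇒m<n∨m≡n 2i≤n
... | inj₂ refl = trans (weight-η-full i (2 * i) ≤-refl) (⌊bit+2*n/2⌋ true i)
weight-η i (suc n) _ | inj₁ (s≤s 2i≤n) =
  trans (cong weight (η-padded i n 2i≤n)) (weight-η i n 2i≤n)

alternating : ∀ {n} → Bool → ℕ → Labeling (2 + n)
alternating {n} false i = lab false (ξ i n) false
alternating {n} true  i = lab true  (η i n) false

representative : (n : ℕ) → ℕ → Labeling (2 + n)
representative n zero    = lab false (replicate n false) true
representative n (suc w) = alternating (odd w) ⌊ w /2⌋

classIndex-alternating : ∀ {n} p i → bit p + 2 * i ≤ suc n →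
  classIndex (alternating {n} p i) ≡ suc (bit p + 2 * i)
classIndex-alternating {n} false i bound = begin
  classIndex (lab false (ξ i n) false)      ≡⟨ classIndex-lab false (ξ i n) false ⟩
  classCode (changes false (ξ i n)) false
    ≡⟨ cong (λ w → classCode w false) (changes-ξ i n (2*≤n⇒≤⌊n/2⌋ i bound)) ⟩
  classCode (2 * i) false                   ≡⟨ classCode-false (2 * i) ⟩
  suc (2 * i)                               ∎
  where open ≡-Reasoning
classIndex-alternating {n} true  i (s≤s bound) =
  trans (classIndex-lab true (η i n) false)
        (cong (λ w → classCode w false) (changes-η i n true bound))

weight-alternating : ∀ {n} p i → bit p + 2 * i ≤ suc n → weight (alternating {n} p i) ≡ bit p + i
weight-alternating {n} false i bound       =
  trans (weight-lab-false false (ξ i n)) (weight-ξ i n (2*≤n⇒≤⌊n/2⌋ i bound))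
weight-alternating {n} true  i (s≤s bound) =
  trans (weight-lab-false true (η i n)) (cong suc (weight-η i n bound))

IsRep-alternating : ∀ {n} p i → bit p + 2 * i ≤ suc n → IsRep n (alternating p i)
IsRep-alternating {n} false i bound       = inj₂ (inj₁ (i , 2*≤n⇒≤⌊n/2⌋ i bound , refl))
IsRep-alternating {n} true  i (s≤s bound) =
  inj₂ (inj₂ (i , subst (i ≤_) (sym (⌈n∸1/2⌉≡⌊n/2⌋ n)) (2*≤n⇒≤⌊n/2⌋ i bound) , refl))

IsRep-cases : ∀ {n} {b : Labeling (2 + n)} → IsRep n b →
  b ≡ representative n 0 ⊎ ∃[ p ] ∃[ i ] bit p + 2 * i ≤ suc n × b ≡ alternating p i
IsRep-cases     (inj₁ b≡)                  = inj₁ b≡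
IsRep-cases {n} (inj₂ (inj₁ (i , i≤ , b≡))) = inj₂ (false , i , ≤⌊n/2⌋⇒2*≤n (suc n) i≤ , b≡)
IsRep-cases {n} (inj₂ (inj₂ (i , i≤ , b≡))) =
  inj₂ (true , i , s≤s (≤⌊n/2⌋⇒2*≤n n (subst (i ≤_) (⌈n∸1/2⌉≡⌊n/2⌋ n) i≤)) , b≡)

classIndex-representative-zero : ∀ n → classIndex (representative n 0) ≡ 0
classIndex-representative-zero n =
  trans (classIndex-lab false (replicate n false) true)
        (cong (λ w → classCode w true) (changes-zeros n))

weight-representative-zero : ∀ n → weight (representative n 0) ≡ 1
weight-representative-zero zero    = refl
weight-representative-zero (suc n) = weight-representative-zero n

representative-bound : ∀ {n w} → w ≤ suc n → bit (odd w) + 2 * ⌊ w /2⌋ ≤ suc n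
representative-bound {n} {w} = subst (_≤ suc n) (sym (bit-odd+2*⌊n/2⌋ w))

classIndex-representative : ∀ {n} k → k ≤ 2 + n → classIndex (representative n k) ≡ k
classIndex-representative {n} zero    _        = classIndex-representative-zero n
classIndex-representative     (suc w) (s≤s w≤) = trans
  (classIndex-alternating (odd w) ⌊ w /2⌋ (representative-bound w≤)) (cong suc (bit-odd+2*⌊n/2⌋ w))

IsRep-representative : ∀ {n} k → k ≤ 2 + n → IsRep n (representative n k)
IsRep-representative zero    _        = inj₁ refl
IsRep-representative (suc w) (s≤s w≤) = IsRep-alternating (odd w) ⌊ w /2⌋ (representative-bound w≤)

IsRep⇒≡representative : ∀ {n} {b : Labeling (2 + n)} → IsRep n b →
  b ≡ representative n (classIndex b)
IsRep⇒≡representative {n} isRep with IsRep-cases isRep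
... | inj₁ refl = cong (representative n) (sym (classIndex-representative-zero n))
... | inj₂ (p , i , bound , refl) = sym (begin
  representative n (classIndex (alternating p i))
    ≡⟨ cong (representative n) (classIndex-alternating p i bound) ⟩
  alternating (odd (bit p + 2 * i)) ⌊ bit p + 2 * i /2⌋
    ≡⟨ cong₂ alternating (odd-bit+2*n p i) (⌊bit+2*n/2⌋ p i) ⟩
  alternating p i
    ∎)
  where open ≡-Reasoning

weight≡minWeight : ∀ {n} {b : Labeling (2 + n)} → IsRep n b → weight b ≡ minWeight (classIndex b)
weight≡minWeight {n} isRep with IsRep-cases isRep
... | inj₁ refl =
  trans (weight-representative-zero n) (cong minWeight (sym (classIndex-representative-zero n)))
... | inj₂ (p , i , bound , refl) = begin
  weight (alternating p i)                   ≡⟨ weight-alternating p i bound ⟩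
  bit p + i                                  ≡⟨ ⌈bit+2*n/2⌉ p i ⟨
  minWeight (suc (bit p + 2 * i))            ≡⟨ cong minWeight (classIndex-alternating p i bound) ⟨
  minWeight (classIndex (alternating p i))   ∎
  where open ≡-Reasoning

≈-representative : ∀ {n} (b : Labeling (2 + n)) → b ≈[ X n ] representative n (classIndex b)
≈-representative b =
  classIndex≡⇒≈ b _ (sym (classIndex-representative (classIndex b) (classIndex≤ b)))

IsRep⇒IsMinimal : ∀ {n} {b : Labeling (2 + n)} → IsRep n b → IsMinimal (X n) b
IsRep⇒IsMinimal {b = b} isRep c b≈c = begin
  weight b                   ≡⟨ weight≡minWeight isRep ⟩
  minWeight (classIndex b)   ≡⟨ cong minWeight (≈⇒classIndex≡ b≈c) ⟩
  minWeight (classIndex c)   ≤⟨ minWeight≤weight c ⟩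
  weight c                   ∎
  where open ≤-Reasoning

IsRep-≈⇒≡ : ∀ {n} {b c : Labeling (2 + n)} → IsRep n b → IsRep n c → b ≈[ X n ] c → b ≡ c
IsRep-≈⇒≡ {n} {b} {c} isRep-b isRep-c b≈c = begin
  b                                 ≡⟨ IsRep⇒≡representative isRep-b ⟩
  representative n (classIndex b)   ≡⟨ cong (representative n) (≈⇒classIndex≡ b≈c) ⟩
  representative n (classIndex c)   ≡⟨ IsRep⇒≡representative isRep-c ⟨
  c                                 ∎
  where open ≡-Reasoning

≈-IsRep : ∀ {n} (b : Labeling (2 + n)) → ∃[ c ] (IsRep n c × b ≈[ X n ] c)
≈-IsRep b = _ , IsRep-representative (classIndex b) (classIndex≤ b) , ≈-representative b

numClasses-X : ∀ n → NumClasses (X n) (n + 3)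
numClasses-X n = representative n ∘ toℕ , injective , surjective
  where
  open ≡-Reasoning
  bound : (k : Fin (n + 3)) → toℕ k ≤ 2 + n
  bound k = ≤-pred (subst (suc (toℕ k) ≤_) (+-comm n 3) (toℕ<n k))
  injective : ∀ i j → representative n (toℕ i) ≈[ X n ] representative n (toℕ j) → i ≡ j
  injective i j rep≈rep = toℕ-injective (begin
    toℕ i                                   ≡⟨ classIndex-representative (toℕ i) (bound i) ⟨
    classIndex (representative n (toℕ i))   ≡⟨ ≈⇒classIndex≡ rep≈rep ⟩
    classIndex (representative n (toℕ j))   ≡⟨ classIndex-representative (toℕ j) (bound j) ⟩
    toℕ j                                   ∎)
  surjective : ∀ b → ∃[ i ] b ≈[ X n ] representative n (toℕ i)
  surjective b = fromℕ< index<3+n ,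
    subst (λ k → b ≈[ X n ] representative n k) (sym (toℕ-fromℕ< index<3+n)) (≈-representative b)
    where
    index<3+n : classIndex b < n + 3
    index<3+n = subst (classIndex b <_) (+-comm 3 n) (s≤s (classIndex≤ b))

proposition2p51 : (n : ℕ) → 1 ≤ n →
    (∀ b → IsRep n b → IsMinimal (X n) b)
    × (∀ b c → IsRep n b → IsRep n c → b ≈[ X n ] c → b ≡ c)
    × (∀ b → ∃[ c ] (IsRep n c × b ≈[ X n ] c))
    × NumClasses (X n) (n + 3)
proposition2p51 n _ =
  (λ _ → IsRep⇒IsMinimal) , (λ _ _ → IsRep-≈⇒≡) , ≈-IsRep , numClasses-X n
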